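{- Let $\mathfrak{g}^{(k)}(\mathbf{y},\mathbf{z})=(\mathfrak{g}^{(k)}_1(\mathbf{y},\mathbf{z}),\dots,\mathfrak{g}^{(k)}_s(\mathbf{y},\mathbf{z}))$ be a system of homogeneous forms of degree $k$ with rational coefficients, and let $\mathbf{y}$, $\mathbf{y}'$, $\mathbf{z}$ be distinct sets of variables, with $\mathbf{y}'$ of the same size as $\mathbf{y}$. For the system $\tilde{\mathfrak{g}}^{(k)}(\mathbf{y},\mathbf{y}',\mathbf{z})=(\mathfrak{g}^{(k)}(\mathbf{y},\mathbf{z}),\mathfrak{g}^{(k)}(\mathbf{y}',\mathbf{z}))$ of $2s$ forms we have \[h_{\mathbb{Q}}(\tilde{\mathfrak{g}}^{(k)};\mathbf{z})=h_{\mathbb{Q}}(\mathfrak{g}^{(k)};\mathbf{z}).\]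
   Context: Modified Schmidt rank with respect to $\mathbf{z}$: for a form $\mathfrak{F}$ of degree at least 2 in variables including $\mathbf{z}$, $h_{\mathbb{Q}}(\mathfrak{F};\mathbf{z})$ is the minimal $l$ such that $\mathfrak{F}=\sum_{i=1}^lU_iV_i+W(\mathbf{z})$ with $U_i,V_i$ rational forms of degree at least one (in all variables) and $W$ a form in $\mathbf{z}$ only. For a system $(\mathfrak{f}_1,\dots,\mathfrak{f}_t)$ of forms of the same degree, $h_{\mathbb{Q}}(\mathfrak{f};\mathbf{z})=\min\{h_{\mathbb{Q}}(\sum_j\lambda_j\mathfrak{f}_j;\mathbf{z}):\lambda\in\mathbb{Q}^t\setminus\{0\}\}$. -}

module Defs where

open import Data.Nat as ℕ using (ℕ; _≤_)
import Data.Nat.Properties as ℕP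
open import Data.Rational as ℚ using (ℚ; 0ℚ)
open import Data.Fin using (Fin; zero; suc; splitAt)
open import Data.Vec as Vec using (Vec; _++_; take; drop; replicate; zipWith)
import Data.Vec.Properties as VecP
open import Data.List as List using (List; []; _∷_)
open import Data.Product using (Σ; _×_; _,_; ∃; ∃-syntax)
open import Data.Sum using (inj₁; inj₂)
open import Relation.Binary.PropositionalEquality using (_≡_; _≢_)
open import Relation.Nullary using (¬_; yes; no)

-- Exponent vectors (monomials) in N variables
Mono : ℕ → Set
Mono N = Vec ℕ N

degM : ∀ {N} → Mono N → ℕ
degM = Vec.sum

-- Polynomials with rational coefficients in N variables, as finite lists of terms
Poly : ℕ → Set
Poly N = List (ℚ × Mono N)

coeff : ∀ {N} → Poly N → Mono N → ℚ
coeff [] m = 0ℚ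
coeff ((c , e) ∷ p) m with VecP.≡-dec ℕP._≟_ e m
... | yes _ = c ℚ.+ coeff p m
... | no _  = coeff p m

_≈P_ : ∀ {N} → Poly N → Poly N → Set
p ≈P q = ∀ m → coeff p m ≡ coeff q m

0P : ∀ {N} → Poly N
0P = []

_+P_ : ∀ {N} → Poly N → Poly N → Poly N
_+P_ = List._++_

scaleP : ∀ {N} → ℚ → Poly N → Poly N
scaleP c = List.map (λ { (d , e) → (c ℚ.* d , e) })

_*P_ : ∀ {N} → Poly N → Poly N → Poly N
p *P q = List.concatMap (λ { (c , e) → List.map (λ { (d , f) → (c ℚ.* d , zipWith ℕ._+_ e f) }) q }) p

sumP : ∀ {N} l → (Fin l → Poly N) → Poly N
sumP ℕ.zero f = 0P
sumP (ℕ.suc l) f = f zero +P sumP l (λ i → f (suc i))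

IsForm : ∀ {N} → ℕ → Poly N → Set
IsForm d p = ∀ m → coeff p m ≢ 0ℚ → degM m ≡ d

-- variables are (x , z) with z the last n variables; p involves only z
OnlyZ : ∀ a n → Poly (a ℕ.+ n) → Set
OnlyZ a n p = ∀ m → coeff p m ≢ 0ℚ → take a m ≡ replicate a 0

Decomp : ∀ a n → Poly (a ℕ.+ n) → ℕ → Set
Decomp a n F l =
  Σ (Fin l → Poly (a ℕ.+ n)) λ U → Σ (Fin l → Poly (a ℕ.+ n)) λ V → Σ (Poly (a ℕ.+ n)) λ W →
    (∀ i → ∃[ d ] (1 ≤ d × IsForm d (U i))) ×
    (∀ i → ∃[ d ] (1 ≤ d × IsForm d (V i))) ×
    (∃[ d ] IsForm d W) × OnlyZ a n W ×
    (F ≈P (sumP l (λ i → U i *P V i) +P W))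

IsSchmidtRankZ : ∀ a n → Poly (a ℕ.+ n) → ℕ → Set
IsSchmidtRankZ a n F r = Decomp a n F r × (∀ l → Decomp a n F l → r ≤ l)

combo : ∀ {N} s → (Fin s → ℚ) → (Fin s → Poly N) → Poly N
combo s c f = sumP s (λ j → scaleP (c j) (f j))

SysDecomp : ∀ a n t → (Fin t → Poly (a ℕ.+ n)) → ℕ → Set
SysDecomp a n t f l = Σ (Fin t → ℚ) λ c → (¬ (∀ j → c j ≡ 0ℚ)) × Decomp a n (combo t c f) l

IsSysSchmidtRankZ : ∀ a n t → (Fin t → Poly (a ℕ.+ n)) → ℕ → Set
IsSysSchmidtRankZ a n t f r = SysDecomp a n t f r × (∀ l → SysDecomp a n t f l → r ≤ l)

-- substitutions (y , z) ↦ (y , y' , z) into variables y, y', z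
-- g(y,z) as polynomial in (y,y',z)
embedY : ∀ m n → Poly (m ℕ.+ n) → Poly ((m ℕ.+ m) ℕ.+ n)
embedY m n = List.map (λ { (c , e) → (c , (take m e ++ replicate m 0) ++ drop m e) })

embedY' : ∀ m n → Poly (m ℕ.+ n) → Poly ((m ℕ.+ m) ℕ.+ n)
embedY' m n = List.map (λ { (c , e) → (c , (replicate m 0 ++ take m e) ++ drop m e) })

doubled : ∀ m n s → (Fin s → Poly (m ℕ.+ n)) → Fin (s ℕ.+ s) → Poly ((m ℕ.+ m) ℕ.+ n)
doubled m n s g i with splitAt s i
... | inj₁ j = embedY m n (g j)
... | inj₂ j = embedY' m n (g j)

module Submission where

-- Both inequalities come from substitutions of variables, which carry decompositions
-- F ≈ Σ UᵢVᵢ + W(z) to decompositions of the same length.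
--   h(doubled) ≤ h(g): for λ ≠ 0, (λ·g)(y,z) is the combination (λ , 0) of the doubled system.
--   h(g) ≤ h(doubled): a nonzero (λ , λ') has, say, λ ≠ 0.  Setting y' = 0 turns
--     (λ·g)(y,z) + (λ'·g)(y',z) into (λ·g)(y,z) + (λ'·g)(0,z), and the second summand, a form of
--     degree k in z alone, is absorbed into W once W is made homogeneous of degree k.

open import Defs
open import Data.Nat as ℕ using (ℕ; _≤_)
import Data.Nat.Properties as ℕP
open import Data.Rational using (ℚ; 0ℚ; 1ℚ; _+_; _*_; -_)
import Data.Rational.Properties as ℚP
open import Data.Rational.Solver using (module +-*-Solver)
open import Data.Bool using (Bool; true; false; if_then_else_; _∧_)
import Data.Bool.Properties as BoolP
open import Data.Fin using (Fin; zero; suc; _↑ˡ_; _↑ʳ_; splitAt)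
import Data.Fin.Properties as FinP
open import Data.Vec as Vec using (Vec; _++_; take; drop; replicate; zipWith)
import Data.Vec.Properties as VecP
open import Data.List as List using (List; []; _∷_)
import Data.List.Properties as ListP
open import Data.List.Membership.Propositional using (_∈_)
open import Data.List.Membership.Propositional.Properties using (∈-deduplicate⁺; ∈-++⁺ˡ; ∈-++⁺ʳ)
open import Data.List.Relation.Unary.Any using (here; there)
open import Data.List.Relation.Unary.All as All using (All)
open import Data.List.Relation.Unary.Unique.Propositional using (Unique)
open import Data.List.Relation.Unary.AllPairs using (_∷_)
open import Data.List.Relation.Unary.Unique.DecPropositional.Properties using (deduplicate-!)
open import Data.Product using (Σ; _×_; _,_; proj₁; proj₂; ∃)
open import Data.Sum using (inj₁; inj₂; [_,_]′)
open import Data.Empty using (⊥-elim)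
open import Data.Unit using (tt)
open import Function using (_∘_)
open import Function.Bundles using (_⇔_; mk⇔)
open import Relation.Binary.PropositionalEquality
open import Relation.Nullary using (¬_; Dec; yes; no)
open import Relation.Unary using (Decidable)
open import Algebra.Properties.CommutativeSemigroup ℕP.+-commutativeSemigroup using (interchange)

open +-*-Solver using (solve; _:+_; _:*_; _:=_; con)

private
  variable
    N A B : ℕ

_⊕_ : Mono N → Mono N → Mono N
_⊕_ = zipWith ℕ._+_

_≟M_ : (e f : Mono N) → Dec (e ≡ f)
_≟M_ = VecP.≡-dec ℕP._≟_

δ : Mono N → Mono N → ℚ
δ e m with e ≟M m
... | yes _ = 1ℚ
... | no _  = 0ℚ

δ-self : (e : Mono N) → δ e e ≡ 1ℚ
δ-self e with e ≟M e
... | yes _ = refl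
... | no e≢e = ⊥-elim (e≢e refl)

δ-miss : {e m : Mono N} → e ≢ m → δ e m ≡ 0ℚ
δ-miss {e = e} {m} e≢m with e ≟M m
... | yes e≡m = ⊥-elim (e≢m e≡m)
... | no _ = refl

-- Every coefficient is such a pairing (with a delta weight),
-- and all operations used below are computed through it.
lin : Poly N → (Mono N → ℚ) → ℚ
lin [] G = 0ℚ
lin ((c , e) ∷ p) G = c * G e + lin p G

coeff-lin : (p : Poly N) (m : Mono N) → coeff p m ≡ lin p (λ e → δ e m)
coeff-lin [] m = refl
coeff-lin ((c , e) ∷ p) m with e ≟M m
... | yes _ = cong₂ _+_ (sym (ℚP.*-identityʳ c)) (coeff-lin p m)
... | no _  = trans (coeff-lin p m) (sym (trans (cong (_+ lin p (λ e → δ e m)) (ℚP.*-zeroʳ c)) (ℚP.+-identityˡ _)))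

lin-cong : (p : Poly N) {G H : Mono N → ℚ} → (∀ e → G e ≡ H e) → lin p G ≡ lin p H
lin-cong [] G≗H = refl
lin-cong ((c , e) ∷ p) G≗H = cong₂ _+_ (cong (c *_) (G≗H e)) (lin-cong p G≗H)

lin-++ : (p q : Poly N) (G : Mono N → ℚ) → lin (p +P q) G ≡ lin p G + lin q G
lin-++ [] q G = sym (ℚP.+-identityˡ _)
lin-++ ((c , e) ∷ p) q G =
  trans (cong (c * G e +_) (lin-++ p q G)) (sym (ℚP.+-assoc (c * G e) (lin p G) (lin q G)))

lin-scale : (c : ℚ) (p : Poly N) (G : Mono N → ℚ) → lin (scaleP c p) G ≡ c * lin p G
lin-scale c [] G = sym (ℚP.*-zeroʳ c)
lin-scale c ((d , e) ∷ p) G = trans (cong (c * d * G e +_) (lin-scale c p G))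
  (solve 4 (λ c d g r → c :* d :* g :+ c :* r := c :* (d :* g :+ r)) refl c d (G e) (lin p G))

lin-*P : (p q : Poly N) (G : Mono N → ℚ) → lin (p *P q) G ≡ lin p (λ e → lin q (λ f → G (e ⊕ f)))
lin-*P [] q G = refl
lin-*P ((c , e) ∷ p) q G =
  trans (lin-++ (List.map _ q) (p *P q) G) (cong₂ _+_ (row q) (lin-*P p q G))
  where
  row : ∀ q → lin (List.map (λ { (d , f) → (c * d , e ⊕ f) }) q) G ≡ c * lin q (λ f → G (e ⊕ f))
  row [] = sym (ℚP.*-zeroʳ c)
  row ((d , f) ∷ q) = trans (cong (c * d * G (e ⊕ f) +_) (row q))
    (solve 4 (λ c d g r → c :* d :* g :+ c :* r := c :* (d :* g :+ r)) refl c d (G (e ⊕ f)) _)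

coeff-++ : (p q : Poly N) (m : Mono N) → coeff (p +P q) m ≡ coeff p m + coeff q m
coeff-++ p q m = begin
  coeff (p +P q) m                                  ≡⟨ coeff-lin (p +P q) m ⟩
  lin (p +P q) (λ e → δ e m)                        ≡⟨ lin-++ p q _ ⟩
  lin p (λ e → δ e m) + lin q (λ e → δ e m)         ≡⟨ sym (cong₂ _+_ (coeff-lin p m) (coeff-lin q m)) ⟩
  coeff p m + coeff q m                             ∎
  where open ≡-Reasoning

coeff-scale : (c : ℚ) (p : Poly N) (m : Mono N) → coeff (scaleP c p) m ≡ c * coeff p m
coeff-scale c p m = begin
  coeff (scaleP c p) m                 ≡⟨ coeff-lin (scaleP c p) m ⟩
  lin (scaleP c p) (λ e → δ e m)       ≡⟨ lin-scale c p _ ⟩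
  c * lin p (λ e → δ e m)              ≡⟨ cong (c *_) (sym (coeff-lin p m)) ⟩
  c * coeff p m                        ∎
  where open ≡-Reasoning

ΣL : List (Mono N) → (Mono N → ℚ) → ℚ
ΣL [] F = 0ℚ
ΣL (e ∷ L) F = F e + ΣL L F

ΣL-cong : (L : List (Mono N)) {F H : Mono N → ℚ} → (∀ {e} → e ∈ L → F e ≡ H e) → ΣL L F ≡ ΣL L H
ΣL-cong [] F≗H = refl
ΣL-cong (e ∷ L) F≗H = cong₂ _+_ (F≗H (here refl)) (ΣL-cong L (F≗H ∘ there))

ΣL-zero : (L : List (Mono N)) (F : Mono N → ℚ) → (∀ {e} → e ∈ L → F e ≡ 0ℚ) → ΣL L F ≡ 0ℚ
ΣL-zero L F F≡0 = trans (ΣL-cong L F≡0) (vanish L)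
  where
  vanish : ∀ L → ΣL L (λ _ → 0ℚ) ≡ 0ℚ
  vanish [] = refl
  vanish (_ ∷ L) = trans (ℚP.+-identityˡ _) (vanish L)

ΣL-+ : (L : List (Mono N)) (F H : Mono N → ℚ) → ΣL L (λ e → F e + H e) ≡ ΣL L F + ΣL L H
ΣL-+ [] F H = sym (ℚP.+-identityˡ 0ℚ)
ΣL-+ (e ∷ L) F H = trans (cong (F e + H e +_) (ΣL-+ L F H))
  (solve 4 (λ a b c d → (a :+ b) :+ (c :+ d) := (a :+ c) :+ (b :+ d)) refl (F e) (H e) (ΣL L F) (ΣL L H))

ΣL-δ : (L : List (Mono N)) → Unique L → ∀ {e₀} → e₀ ∈ L → (H : Mono N → ℚ) →
  ΣL L (λ e → δ e₀ e * H e) ≡ H e₀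
ΣL-δ (e ∷ L) (e∉L ∷ _) (here refl) H = begin
  δ e e * H e + ΣL L (λ f → δ e f * H f) ≡⟨ cong₂ _+_ (cong (_* H e) (δ-self e)) (ΣL-zero L _ off) ⟩
  1ℚ * H e + 0ℚ                          ≡⟨ trans (ℚP.+-identityʳ _) (ℚP.*-identityˡ (H e)) ⟩
  H e                                    ∎
  where
  open ≡-Reasoning
  off : ∀ {f} → f ∈ L → δ e f * H f ≡ 0ℚ
  off {f} f∈L = trans (cong (_* H f) (δ-miss (All.lookup e∉L f∈L))) (ℚP.*-zeroˡ (H f))
ΣL-δ (e ∷ L) (e∉L ∷ uL) {e₀} (there e₀∈L) H = begin
  δ e₀ e * H e + ΣL L (λ f → δ e₀ f * H f) ≡⟨ cong₂ _+_ miss (ΣL-δ L uL e₀∈L H) ⟩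
  0ℚ + H e₀                                ≡⟨ ℚP.+-identityˡ _ ⟩
  H e₀                                     ∎
  where
  open ≡-Reasoning
  miss : δ e₀ e * H e ≡ 0ℚ
  miss = trans (cong (_* H e) (δ-miss (λ e₀≡e → All.lookup e∉L e₀∈L (sym e₀≡e)))) (ℚP.*-zeroˡ (H e))

exps : Poly N → List (Mono N)
exps = List.map proj₂

lin-as-sum : (p : Poly N) (L : List (Mono N)) → Unique L → (∀ {e} → e ∈ exps p → e ∈ L) →
  (G : Mono N → ℚ) → lin p G ≡ ΣL L (λ e → coeff p e * G e)
lin-as-sum [] L uL cover G = sym (ΣL-zero L _ (λ {e} _ → ℚP.*-zeroˡ (G e)))
lin-as-sum ((c , e₀) ∷ p) L uL cover G = begin
  c * G e₀ + lin p G
    ≡⟨ cong₂ _+_ (sym (ΣL-δ L uL (cover (here refl)) (λ e → c * G e))) (lin-as-sum p L uL (cover ∘ there) G) ⟩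
  ΣL L (λ e → δ e₀ e * (c * G e)) + ΣL L (λ e → coeff p e * G e)
    ≡⟨ sym (ΣL-+ L _ _) ⟩
  ΣL L (λ e → δ e₀ e * (c * G e) + coeff p e * G e)
    ≡⟨ ΣL-cong L (λ {e} _ → term e) ⟩
  ΣL L (λ e → coeff ((c , e₀) ∷ p) e * G e) ∎
  where
  open ≡-Reasoning
  term : ∀ e → δ e₀ e * (c * G e) + coeff p e * G e ≡ coeff ((c , e₀) ∷ p) e * G e
  term e = begin
    δ e₀ e * (c * G e) + coeff p e * G e
      ≡⟨ solve 4 (λ d c g x → d :* (c :* g) :+ x :* g := (c :* d :+ x) :* g) refl (δ e₀ e) c (G e) (coeff p e) ⟩
    (c * δ e₀ e + coeff p e) * G e
      ≡⟨ cong (λ x → (c * δ e₀ e + x) * G e) (coeff-lin p e) ⟩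
    lin ((c , e₀) ∷ p) (λ f → δ f e) * G e
      ≡⟨ cong (_* G e) (sym (coeff-lin ((c , e₀) ∷ p) e)) ⟩
    coeff ((c , e₀) ∷ p) e * G e ∎

lin-resp : (p q : Poly N) → p ≈P q → (G : Mono N → ℚ) → lin p G ≡ lin q G
lin-resp p q p≈q G = begin
  lin p G                          ≡⟨ lin-as-sum p L (deduplicate-! _≟M_ _) (support ∘ ∈-++⁺ˡ) G ⟩
  ΣL L (λ e → coeff p e * G e)     ≡⟨ ΣL-cong L (λ {e} _ → cong (_* G e) (p≈q e)) ⟩
  ΣL L (λ e → coeff q e * G e)     ≡⟨ sym (lin-as-sum q L (deduplicate-! _≟M_ _) (support ∘ ∈-++⁺ʳ (exps p)) G) ⟩
  lin q G                          ∎
  where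
  open ≡-Reasoning
  L : List (Mono _)
  L = List.deduplicate _≟M_ (exps p List.++ exps q)
  support : ∀ {e} → e ∈ exps p List.++ exps q → e ∈ L
  support = ∈-deduplicate⁺ _≟M_

-- p has support in S: every monomial with a nonzero coefficient lies in S.
-- Both IsForm d (S = degree d) and OnlyZ a n (S = no x-variables) are of this shape.
Supp : (Mono N → Set) → Poly N → Set
Supp S p = ∀ m → coeff p m ≢ 0ℚ → S m

supp-vanish : {S : Mono N → Set} (p : Poly N) → Supp S p → ∀ m → ¬ S m → coeff p m ≡ 0ℚ
supp-vanish p supp m ¬Sm with coeff p m ℚP.≟ 0ℚ
... | yes p₀ = p₀
... | no p≢0 = ⊥-elim (¬Sm (supp m p≢0))

supp-intro : {S : Mono N → Set} (p : Poly N) → Decidable S → (∀ m → ¬ S m → coeff p m ≡ 0ℚ) → Supp S p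
supp-intro p S? vanish m p≢0 with S? m
... | yes Sm = Sm
... | no ¬Sm = ⊥-elim (p≢0 (vanish m ¬Sm))

lin-supp : {S : Mono N → Set} (p : Poly N) → Supp S p → (G : Mono N → ℚ) → (∀ e → S e → G e ≡ 0ℚ) →
  lin p G ≡ 0ℚ
lin-supp p supp G G₀ = trans (lin-as-sum p L (deduplicate-! _≟M_ _) (∈-deduplicate⁺ _≟M_) G) (ΣL-zero L _ term)
  where
  L : List (Mono _)
  L = List.deduplicate _≟M_ (exps p)
  term : ∀ {e} → e ∈ L → coeff p e * G e ≡ 0ℚ
  term {e} _ with coeff p e ℚP.≟ 0ℚ
  ... | yes p₀ = trans (cong (_* G e) p₀) (ℚP.*-zeroˡ (G e))
  ... | no p≢0 = trans (cong (coeff p e *_) (G₀ e (supp e p≢0))) (ℚP.*-zeroʳ (coeff p e))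

module _ {S : Mono N → Set} (S? : Decidable S) where

  supp-++ : (p q : Poly N) → Supp S p → Supp S q → Supp S (p +P q)
  supp-++ p q sp sq = supp-intro (p +P q) S? λ m ¬Sm →
    trans (coeff-++ p q m) (trans (cong₂ _+_ (supp-vanish p sp m ¬Sm) (supp-vanish q sq m ¬Sm)) (ℚP.+-identityˡ 0ℚ))

  supp-scale : (c : ℚ) (p : Poly N) → Supp S p → Supp S (scaleP c p)
  supp-scale c p sp = supp-intro (scaleP c p) S? λ m ¬Sm →
    trans (coeff-scale c p m) (trans (cong (c *_) (supp-vanish p sp m ¬Sm)) (ℚP.*-zeroʳ c))

  supp-sumP : (l : ℕ) (f : Fin l → Poly N) → (∀ i → Supp S (f i)) → Supp S (sumP l f)
  supp-sumP ℕ.zero f sf m 0≢0 = ⊥-elim (0≢0 refl)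
  supp-sumP (ℕ.suc l) f sf = supp-++ (f zero) _ (sf zero) (supp-sumP l (f ∘ suc) (sf ∘ suc))

  supp-combo : (t : ℕ) (c : Fin t → ℚ) (f : Fin t → Poly N) → (∀ j → Supp S (f j)) → Supp S (combo t c f)
  supp-combo t c f sf = supp-sumP t _ (λ j → supp-scale (c j) (f j) (sf j))

degM-⊕ : (e f : Mono N) → degM (e ⊕ f) ≡ degM e ℕ.+ degM f
degM-⊕ Vec.[] Vec.[] = refl
degM-⊕ (x Vec.∷ e) (y Vec.∷ f) = trans (cong ((x ℕ.+ y) ℕ.+_) (degM-⊕ e f)) (interchange x y (degM e) (degM f))

deg? : (d : ℕ) → Decidable (λ (m : Mono N) → degM m ≡ d)
deg? d m = degM m ℕP.≟ d

form-*P : ∀ a b (U V : Poly N) → IsForm a U → IsForm b V → IsForm (a ℕ.+ b) (U *P V)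
form-*P a b U V fU fV = supp-intro (U *P V) (deg? (a ℕ.+ b)) λ m deg≢ → begin
  coeff (U *P V) m                                  ≡⟨ coeff-lin (U *P V) m ⟩
  lin (U *P V) (λ e → δ e m)                        ≡⟨ lin-*P U V _ ⟩
  lin U (λ e → lin V (λ f → δ (e ⊕ f) m))           ≡⟨ lin-supp U fU _ (λ e de → lin-supp V fV _ (λ f df → δ-miss (wrong e f de df deg≢))) ⟩
  0ℚ                                                ∎
  where
  open ≡-Reasoning
  wrong : ∀ e f {m} → degM e ≡ a → degM f ≡ b → degM m ≢ a ℕ.+ b → e ⊕ f ≢ m
  wrong e f de df deg≢ refl = deg≢ (trans (degM-⊕ e f) (cong₂ ℕ._+_ de df))

forms-≈ : ∀ k (p q : Poly N) → IsForm k p → IsForm k q →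
  (∀ m → degM m ≡ k → coeff p m ≡ coeff q m) → p ≈P q
forms-≈ k p q fp fq agree m with degM m ℕP.≟ k
... | yes dk = agree m dk
... | no ¬dk = trans (supp-vanish p fp m ¬dk) (sym (supp-vanish q fq m ¬dk))

sumP-cong : (l : ℕ) {f g : Fin l → Poly N} → (∀ i → f i ≡ g i) → sumP l f ≡ sumP l g
sumP-cong ℕ.zero fg = refl
sumP-cong (ℕ.suc l) fg = cong₂ _+P_ (fg zero) (sumP-cong l (fg ∘ suc))

coeff-sumP-cong : (l : ℕ) (f g : Fin l → Poly N) (m : Mono N) → (∀ i → coeff (f i) m ≡ coeff (g i) m) →
  coeff (sumP l f) m ≡ coeff (sumP l g) m
coeff-sumP-cong ℕ.zero f g m fg = refl
coeff-sumP-cong (ℕ.suc l) f g m fg = begin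
  coeff (f zero +P sumP l (f ∘ suc)) m          ≡⟨ coeff-++ (f zero) _ m ⟩
  coeff (f zero) m + coeff (sumP l (f ∘ suc)) m ≡⟨ cong₂ _+_ (fg zero) (coeff-sumP-cong l (f ∘ suc) (g ∘ suc) m (fg ∘ suc)) ⟩
  coeff (g zero) m + coeff (sumP l (g ∘ suc)) m ≡⟨ sym (coeff-++ (g zero) _ m) ⟩
  coeff (g zero +P sumP l (g ∘ suc)) m          ∎
  where open ≡-Reasoning

keep : {P : Set} → Dec P → Poly N → Poly N
keep (yes _) p = p
keep (no _)  p = 0P

keep-supp : {S : Mono N → Set} {P : Set} (dec : Dec P) (p : Poly N) → Supp S p → Supp S (keep dec p)
keep-supp (yes _) p sp = sp
keep-supp (no _)  p sp m 0≢0 = ⊥-elim (0≢0 refl)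

keep-*P : {P : Set} (dec : Dec P) (U V : Poly N) → keep dec U *P keep dec V ≡ keep dec (U *P V)
keep-*P (yes _) U V = refl
keep-*P (no _)  U V = refl

keep-form : ∀ a k (p : Poly N) → IsForm a p → (dec : Dec (a ≡ k)) → IsForm k (keep dec p)
keep-form a k p fp (yes refl) = fp
keep-form a k p fp (no _) m 0≢0 = ⊥-elim (0≢0 refl)

keep-agree : ∀ a k (p : Poly N) → IsForm a p → (dec : Dec (a ≡ k)) →
  ∀ m → degM m ≡ k → coeff p m ≡ coeff (keep dec p) m
keep-agree a k p fp (yes _) m dm = refl
keep-agree a k p fp (no a≢k) m dm = supp-vanish p fp m (λ dma → a≢k (trans (sym dma) dm))

zPart : ∀ a n (F : Poly (a ℕ.+ n)) l → Decomp a n F l → Poly (a ℕ.+ n)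
zPart a n F l (_ , _ , W , _) = W

Decomp-resp : ∀ a n (F F' : Poly (a ℕ.+ n)) l → F ≈P F' → Decomp a n F' l → Decomp a n F l
Decomp-resp a n F F' l F≈F' (U , V , W , fU , fV , fW , ozW , F'≈) = U , V , W , fU , fV , fW , ozW , (λ m → trans (F≈F' m) (F'≈ m))

keep-*P-form : ∀ a b k (U V : Poly N) → IsForm a U → IsForm b V → (dec : Dec (a ℕ.+ b ≡ k)) →
  IsForm k (keep dec U *P keep dec V) × (∀ m → degM m ≡ k → coeff (U *P V) m ≡ coeff (keep dec U *P keep dec V) m)
keep-*P-form a b k U V fU fV dec =
  subst (IsForm k) (sym (keep-*P dec U V)) (keep-form _ k _ fUV dec) ,
  λ m dm → trans (keep-agree _ k _ fUV dec m dm) (cong (λ X → coeff X m) (sym (keep-*P dec U V)))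
  where
  fUV : IsForm (a ℕ.+ b) (U *P V)
  fUV = form-*P a b U V fU fV

-- A form F of degree k admitting a decomposition of length l admits one whose z-part is a
-- form of degree k: discard every product UᵢVᵢ, and W, whose degree is not k.
homogenize : ∀ a n k (F : Poly (a ℕ.+ n)) l → IsForm k F → (D : Decomp a n F l) →
  Σ (Decomp a n F l) (λ D' → IsForm k (zPart a n F l D'))
homogenize a n k F l fF (U , V , W , fU , fV , (d , fW) , ozW , F≈) =
  (U' , V' , W' , fU' , fV' , (k , fW') , keep-supp (d ℕP.≟ k) W ozW , F≈') , fW'
  where
  degU degV : Fin l → ℕ
  degU i = proj₁ (fU i)
  degV i = proj₁ (fV i)
  keepᵢ : ∀ i → Dec (degU i ℕ.+ degV i ≡ k)
  keepᵢ i = degU i ℕ.+ degV i ℕP.≟ k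
  U' V' : Fin l → Poly (a ℕ.+ n)
  U' i = keep (keepᵢ i) (U i)
  V' i = keep (keepᵢ i) (V i)
  productᵢ : ∀ i → IsForm k (U' i *P V' i) × (∀ m → degM m ≡ k → coeff (U i *P V i) m ≡ coeff (U' i *P V' i) m)
  productᵢ i = keep-*P-form (degU i) (degV i) k (U i) (V i) (proj₂ (proj₂ (fU i))) (proj₂ (proj₂ (fV i))) (keepᵢ i)
  W' : Poly (a ℕ.+ n)
  W' = keep (d ℕP.≟ k) W
  fU' : ∀ i → ∃ λ e → 1 ≤ e × IsForm e (U' i)
  fU' i = degU i , proj₁ (proj₂ (fU i)) , keep-supp (keepᵢ i) (U i) (proj₂ (proj₂ (fU i)))
  fV' : ∀ i → ∃ λ e → 1 ≤ e × IsForm e (V' i)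
  fV' i = degV i , proj₁ (proj₂ (fV i)) , keep-supp (keepᵢ i) (V i) (proj₂ (proj₂ (fV i)))
  fW' : IsForm k W'
  fW' = keep-form d k W fW (d ℕP.≟ k)
  RHS RHS' : Poly (a ℕ.+ n)
  RHS = sumP l (λ i → U i *P V i) +P W
  RHS' = sumP l (λ i → U' i *P V' i) +P W'
  agree : ∀ m → degM m ≡ k → coeff RHS m ≡ coeff RHS' m
  agree m dm = begin
    coeff RHS m                                         ≡⟨ coeff-++ (sumP l _) W m ⟩
    coeff (sumP l (λ i → U i *P V i)) m + coeff W m
      ≡⟨ cong₂ _+_ (coeff-sumP-cong l _ _ m (λ i → proj₂ (productᵢ i) m dm)) (keep-agree d k W fW (d ℕP.≟ k) m dm) ⟩
    coeff (sumP l (λ i → U' i *P V' i)) m + coeff W' m  ≡⟨ sym (coeff-++ (sumP l _) W' m) ⟩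
    coeff RHS' m                                        ∎
    where open ≡-Reasoning
  F≈' : F ≈P RHS'
  F≈' = forms-≈ k F RHS' fF (supp-++ (deg? k) (sumP l (λ i → U' i *P V' i)) W' (supp-sumP (deg? k) l (λ i → U' i *P V' i) (proj₁ ∘ productᵢ)) fW')
          (λ m dm → trans (F≈ m) (agree m dm))

onlyZ? : ∀ a n → Decidable (λ (m : Mono (a ℕ.+ n)) → take a m ≡ replicate a 0)
onlyZ? a n m = take a m ≟M replicate a 0

absorb : ∀ a n k l (P Q : Poly (a ℕ.+ n)) → IsForm k P → IsForm k Q → OnlyZ a n Q →
  Decomp a n (P +P Q) l → Decomp a n P l
absorb a n k l P Q fP fQ ozQ D with homogenize a n k (P +P Q) l (supp-++ (deg? k) P Q fP fQ) D
... | (U , V , W , fU , fV , _ , ozW , P+Q≈) , fW =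
  U , V , W +P -Q , fU , fV , (k , supp-++ (deg? k) W -Q fW (supp-scale (deg? k) (- 1ℚ) Q fQ)) ,
  supp-++ (onlyZ? a n) W -Q ozW (supp-scale (onlyZ? a n) (- 1ℚ) Q ozQ) , P≈
  where
  -Q : Poly (a ℕ.+ n)
  -Q = scaleP (- 1ℚ) Q
  S : Poly (a ℕ.+ n)
  S = sumP l (λ i → U i *P V i)
  P≈ : P ≈P (S +P (W +P -Q))
  P≈ m = begin
    coeff P m
      ≡⟨ solve 2 (λ p q → p := (p :+ q) :+ con (- 1ℚ) :* q) refl (coeff P m) (coeff Q m) ⟩
    (coeff P m + coeff Q m) + - 1ℚ * coeff Q m
      ≡⟨ cong₂ _+_ (trans (sym (coeff-++ P Q m)) (trans (P+Q≈ m) (coeff-++ S W m))) (sym (coeff-scale (- 1ℚ) Q m)) ⟩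
    (coeff S m + coeff W m) + coeff -Q m
      ≡⟨ ℚP.+-assoc (coeff S m) _ _ ⟩
    coeff S m + (coeff W m + coeff -Q m)
      ≡⟨ cong (coeff S m +_) (sym (coeff-++ W -Q m)) ⟩
    coeff S m + coeff (W +P -Q) m
      ≡⟨ sym (coeff-++ S (W +P -Q) m) ⟩
    coeff (S +P (W +P -Q)) m ∎
    where open ≡-Reasoning

-- Reindexing: apply the monomial map φ to every term, zeroing the coefficient of each term
-- whose monomial fails the test b.  Renaming variables and setting variables to 0 are
-- reindexings.
reindex : (Mono A → Bool) → (Mono A → Mono B) → Poly A → Poly B
reindex b φ = List.map (λ { (c , e) → (if b e then c else 0ℚ) , φ e })

-- The admissible reindexings map decompositions (as in the definition of h_Q) to
-- decompositions: the test is multiplicative, the map additive on exponents, and the kept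
-- monomials keep their degree and stay free of x-variables when they were.
record Admissible (a n a' n' : ℕ) (b : Mono (a ℕ.+ n) → Bool) (φ : Mono (a ℕ.+ n) → Mono (a' ℕ.+ n')) : Set where
  field
    test-⊕ : ∀ e f → b (e ⊕ f) ≡ b e ∧ b f
    map-⊕  : ∀ e f → φ (e ⊕ f) ≡ φ e ⊕ φ f
    map-deg : ∀ e → b e ≡ true → degM (φ e) ≡ degM e
    map-z  : ∀ e → b e ≡ true → take a e ≡ replicate a 0 → take a' (φ e) ≡ replicate a' 0

module _ (b : Mono A → Bool) (φ : Mono A → Mono B) where

  reindex-++ : (p q : Poly A) → reindex b φ (p +P q) ≡ reindex b φ p +P reindex b φ q
  reindex-++ = ListP.map-++ _

  reindex-scale : (c : ℚ) (p : Poly A) → reindex b φ (scaleP c p) ≡ scaleP c (reindex b φ p)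
  reindex-scale c [] = refl
  reindex-scale c ((d , e) ∷ p) = cong₂ _∷_ (cong (_, φ e) (scaled (b e))) (reindex-scale c p)
    where
    scaled : ∀ β → (if β then c * d else 0ℚ) ≡ c * (if β then d else 0ℚ)
    scaled true = refl
    scaled false = sym (ℚP.*-zeroʳ c)

  reindex-sumP : (l : ℕ) (f : Fin l → Poly A) → reindex b φ (sumP l f) ≡ sumP l (reindex b φ ∘ f)
  reindex-sumP ℕ.zero f = refl
  reindex-sumP (ℕ.suc l) f = trans (reindex-++ (f zero) _) (cong (reindex b φ (f zero) +P_) (reindex-sumP l (f ∘ suc)))

  reindex-combo : (t : ℕ) (c : Fin t → ℚ) (f : Fin t → Poly A) → reindex b φ (combo t c f) ≡ combo t c (reindex b φ ∘ f)
  reindex-combo ℕ.zero c f = refl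
  reindex-combo (ℕ.suc t) c f =
    trans (reindex-++ (scaleP (c zero) (f zero)) _) (cong₂ _+P_ (reindex-scale (c zero) (f zero)) (reindex-combo t (c ∘ suc) (f ∘ suc)))

  reindex-*P : (∀ e f → b (e ⊕ f) ≡ b e ∧ b f) → (∀ e f → φ (e ⊕ f) ≡ φ e ⊕ φ f) →
    (p q : Poly A) → reindex b φ (p *P q) ≡ reindex b φ p *P reindex b φ q
  reindex-*P b-⊕ φ-⊕ [] q = refl
  reindex-*P b-⊕ φ-⊕ ((c , e) ∷ p) q = trans (reindex-++ (List.map _ q) (p *P q)) (cong₂ _+P_ (row q) (reindex-*P b-⊕ φ-⊕ p q))
    where
    ite-∧ : ∀ β γ d → (if β ∧ γ then c * d else 0ℚ) ≡ (if β then c else 0ℚ) * (if γ then d else 0ℚ)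
    ite-∧ true true d = refl
    ite-∧ true false d = sym (ℚP.*-zeroʳ c)
    ite-∧ false γ d = sym (ℚP.*-zeroˡ (if γ then d else 0ℚ))
    row : ∀ q → reindex b φ (List.map (λ { (d , f) → (c * d , e ⊕ f) }) q)
              ≡ List.map (λ { (d , f) → ((if b e then c else 0ℚ) * d , φ e ⊕ f) }) (reindex b φ q)
    row [] = refl
    row ((d , f) ∷ q) = cong₂ _∷_ (cong₂ _,_ (trans (cong (λ β → if β then c * d else 0ℚ) (b-⊕ e f)) (ite-∧ (b e) (b f) d)) (φ-⊕ e f)) (row q)

  lin-reindex : (p : Poly A) (G : Mono B → ℚ) → lin (reindex b φ p) G ≡ lin p (λ e → if b e then G (φ e) else 0ℚ)
  lin-reindex [] G = refl
  lin-reindex ((c , e) ∷ p) G = cong₂ _+_ (pulled (b e)) (lin-reindex p G)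
    where
    pulled : ∀ β → (if β then c else 0ℚ) * G (φ e) ≡ c * (if β then G (φ e) else 0ℚ)
    pulled true = refl
    pulled false = trans (ℚP.*-zeroˡ (G (φ e))) (sym (ℚP.*-zeroʳ c))

  coeff-reindex : (p : Poly A) (m : Mono B) → coeff (reindex b φ p) m ≡ lin p (λ e → if b e then δ (φ e) m else 0ℚ)
  coeff-reindex p m = trans (coeff-lin (reindex b φ p) m) (lin-reindex p (λ e → δ e m))

  reindex-≈ : (p q : Poly A) → p ≈P q → reindex b φ p ≈P reindex b φ q
  reindex-≈ p q p≈q m = trans (coeff-reindex p m) (trans (lin-resp p q p≈q _) (sym (coeff-reindex q m)))

  reindex-supp : {S : Mono A → Set} {S' : Mono B → Set} → Decidable S' → (∀ e → b e ≡ true → S e → S' (φ e)) →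
    (p : Poly A) → Supp S p → Supp S' (reindex b φ p)
  reindex-supp {S' = S'} S'? into p sp = supp-intro (reindex b φ p) S'? λ m ¬S'm →
    trans (coeff-reindex p m) (lin-supp p sp _ (λ e Se → weight e Se ¬S'm))
    where
    weight : ∀ e {m} → _ → ¬ S' m → (if b e then δ (φ e) m else 0ℚ) ≡ 0ℚ
    weight e Se ¬S'm with b e in kept
    ... | true = δ-miss (λ φe≡m → ¬S'm (subst S' φe≡m (into e kept Se)))
    ... | false = refl

reindex-retract : (b : Mono A → Bool) (φ : Mono A → Mono B) (ψ : Mono B → Mono A) → (∀ e → b (ψ e) ≡ true) → (∀ e → φ (ψ e) ≡ e) →
  (p : Poly B) → reindex b φ (reindex (λ _ → true) ψ p) ≈P p
reindex-retract b φ ψ kept φψ p m = begin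
  coeff (reindex b φ (reindex (λ _ → true) ψ p)) m
    ≡⟨ coeff-reindex b φ (reindex (λ _ → true) ψ p) m ⟩
  lin (reindex (λ _ → true) ψ p) (λ e → if b e then δ (φ e) m else 0ℚ)
    ≡⟨ lin-reindex (λ _ → true) ψ p _ ⟩
  lin p (λ e → if b (ψ e) then δ (φ (ψ e)) m else 0ℚ)
    ≡⟨ lin-cong p (λ e → cong₂ (λ β f → if β then δ f m else 0ℚ) (kept e) (φψ e)) ⟩
  lin p (λ e → δ e m)
    ≡⟨ sym (coeff-lin p m) ⟩
  coeff p m ∎
  where open ≡-Reasoning

reindex-form : ∀ {a n a' n'} {b : Mono (a ℕ.+ n) → Bool} {φ : Mono (a ℕ.+ n) → Mono (a' ℕ.+ n')} →
  Admissible a n a' n' b φ → ∀ d (p : Poly (a ℕ.+ n)) → IsForm d p → IsForm d (reindex b φ p)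
reindex-form {b = b} {φ} adm d = reindex-supp b φ (deg? d) (λ e kept de → trans (Admissible.map-deg adm e kept) de)

reindex-Decomp : ∀ {a n a' n'} {b : Mono (a ℕ.+ n) → Bool} {φ : Mono (a ℕ.+ n) → Mono (a' ℕ.+ n')} →
  Admissible a n a' n' b φ → ∀ F l → Decomp a n F l → Decomp a' n' (reindex b φ F) l
reindex-Decomp {a} {n} {a'} {n'} {b} {φ} adm F l (U , V , W , fU , fV , (d , fW) , ozW , F≈) =
  (reindex b φ ∘ U) , (reindex b φ ∘ V) , reindex b φ W ,
  (λ i → let (e , 1≤e , f) = fU i in e , 1≤e , reindex-form adm e (U i) f) ,
  (λ i → let (e , 1≤e , f) = fV i in e , 1≤e , reindex-form adm e (V i) f) ,
  (d , reindex-form adm d W fW) , reindex-supp b φ (onlyZ? a' n') map-z W ozW ,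
  (λ m → trans (reindex-≈ b φ F (sumP l (λ i → U i *P V i) +P W) F≈ m) (cong (λ X → coeff X m) image))
  where
  open Admissible adm
  image : reindex b φ (sumP l (λ i → U i *P V i) +P W) ≡ sumP l (λ i → reindex b φ (U i) *P reindex b φ (V i)) +P reindex b φ W
  image = trans (reindex-++ b φ _ W) (cong (_+P reindex b φ W)
            (trans (reindex-sumP b φ l _) (sumP-cong l (λ i → reindex-*P b φ test-⊕ map-⊕ (U i) (V i)))))

zeros : ∀ k → Vec ℕ k
zeros k = replicate k 0

zeros-++ : ∀ a b → zeros a ++ zeros b ≡ zeros (a ℕ.+ b)
zeros-++ ℕ.zero b = refl
zeros-++ (ℕ.suc a) b = cong (0 Vec.∷_) (zeros-++ a b)

degM-zeros : ∀ k → degM (zeros k) ≡ 0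
degM-zeros ℕ.zero = refl
degM-zeros (ℕ.suc k) = degM-zeros k

degM-++ : ∀ {a b} (u : Vec ℕ a) (v : Vec ℕ b) → degM (u ++ v) ≡ degM u ℕ.+ degM v
degM-++ u v = VecP.sum-++ u

take-++ : ∀ {a b} (u : Vec ℕ a) (v : Vec ℕ b) → take a (u ++ v) ≡ u
take-++ {a} u v = VecP.++-injectiveˡ (take a (u ++ v)) u (VecP.take++drop≡id a (u ++ v))

drop-++ : ∀ {a b} (u : Vec ℕ a) (v : Vec ℕ b) → drop a (u ++ v) ≡ v
drop-++ {a} u v = VecP.++-injectiveʳ (take a (u ++ v)) u (VecP.take++drop≡id a (u ++ v))

⊕-++ : ∀ {a b} (u u' : Vec ℕ a) (v v' : Vec ℕ b) → (u ++ v) ⊕ (u' ++ v') ≡ (u ⊕ u') ++ (v ⊕ v')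
⊕-++ u u' v v' = VecP.zipWith-++ ℕ._+_ u v u' v'

degM-take-drop : ∀ a {b} (e : Vec ℕ (a ℕ.+ b)) → degM (take a e) ℕ.+ degM (drop a e) ≡ degM e
degM-take-drop a e = trans (sym (degM-++ (take a e) (drop a e))) (cong degM (VecP.take++drop≡id a e))

isZero : ∀ {k} → Vec ℕ k → Bool
isZero Vec.[] = true
isZero (ℕ.zero Vec.∷ v) = isZero v
isZero (ℕ.suc _ Vec.∷ v) = false

isZero-sound : ∀ {k} (v : Vec ℕ k) → isZero v ≡ true → v ≡ zeros k
isZero-sound Vec.[] _ = refl
isZero-sound (ℕ.zero Vec.∷ v) z = cong (0 Vec.∷_) (isZero-sound v z)

isZero-zeros : ∀ k → isZero (zeros k) ≡ true
isZero-zeros ℕ.zero = refl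
isZero-zeros (ℕ.suc k) = isZero-zeros k

isZero-⊕ : ∀ {k} (u v : Vec ℕ k) → isZero (u ⊕ v) ≡ isZero u ∧ isZero v
isZero-⊕ Vec.[] Vec.[] = refl
isZero-⊕ (ℕ.zero Vec.∷ u) (ℕ.zero Vec.∷ v) = isZero-⊕ u v
isZero-⊕ (ℕ.zero Vec.∷ u) (ℕ.suc _ Vec.∷ v) = sym (BoolP.∧-zeroʳ (isZero u))
isZero-⊕ (ℕ.suc _ Vec.∷ u) (_ Vec.∷ v) = refl

-- The two copies y, y' of the y-variables.
data Side : Set where
  left right : Side

opp : Side → Side
opp left = right
opp right = left

module Block (m : ℕ) where

  put : Side → Vec ℕ m → Vec ℕ (m ℕ.+ m)
  put left y = y ++ zeros m
  put right y = zeros m ++ y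

  get : Side → Vec ℕ (m ℕ.+ m) → Vec ℕ m
  get left = take m
  get right = drop m

  get-put : ∀ t y → get t (put t y) ≡ y
  get-put left y = take-++ y (zeros m)
  get-put right y = drop-++ (zeros m) y

  get-put-opp : ∀ t y → get (opp t) (put t y) ≡ zeros m
  get-put-opp left y = drop-++ y (zeros m)
  get-put-opp right y = take-++ (zeros m) y

  get-opp-put : ∀ t y → get t (put (opp t) y) ≡ zeros m
  get-opp-put left y = take-++ (zeros m) y
  get-opp-put right y = drop-++ y (zeros m)

  put-get : ∀ t w → get (opp t) w ≡ zeros m → put t (get t w) ≡ w
  put-get left w z = trans (cong (take m w ++_) (sym z)) (VecP.take++drop≡id m w)
  put-get right w z = trans (cong (_++ drop m w) (sym z)) (VecP.take++drop≡id m w)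

  put-⊕ : ∀ t y y' → put t (y ⊕ y') ≡ put t y ⊕ put t y'
  put-⊕ left y y' = trans (cong ((y ⊕ y') ++_) (sym (VecP.zipWith-replicate ℕ._+_ 0 0))) (sym (⊕-++ y y' (zeros m) (zeros m)))
  put-⊕ right y y' = trans (cong (_++ (y ⊕ y')) (sym (VecP.zipWith-replicate ℕ._+_ 0 0))) (sym (⊕-++ (zeros m) (zeros m) y y'))

  get-⊕ : ∀ t w w' → get t (w ⊕ w') ≡ get t w ⊕ get t w'
  get-⊕ left w w' = VecP.take-zipWith ℕ._+_ w w'
  get-⊕ right w w' = VecP.drop-zipWith ℕ._+_ w w'

  degM-put : ∀ t y → degM (put t y) ≡ degM y
  degM-put left y = trans (degM-++ y (zeros m)) (trans (cong (degM y ℕ.+_) (degM-zeros m)) (ℕP.+-identityʳ _))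
  degM-put right y = trans (degM-++ (zeros m) y) (cong (ℕ._+ degM y) (degM-zeros m))

  put-zeros : ∀ t → put t (zeros m) ≡ zeros (m ℕ.+ m)
  put-zeros left = zeros-++ m m
  put-zeros right = zeros-++ m m

  get-zeros : ∀ t → get t (zeros (m ℕ.+ m)) ≡ zeros m
  get-zeros t = trans (cong (get t) (sym (put-zeros t))) (get-put t (zeros m))

-- Variables (y , z) and (y , y' , z), with y, y' of size m and z of size n.
module Doubling (m n : ℕ) where
  open Block m

  embedM : Side → Mono (m ℕ.+ n) → Mono ((m ℕ.+ m) ℕ.+ n)
  embedM t e = put t (take m e) ++ drop m e

  restrictM : Side → Mono ((m ℕ.+ m) ℕ.+ n) → Mono (m ℕ.+ n)
  restrictM t e = get t (take (m ℕ.+ m) e) ++ drop (m ℕ.+ m) e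

  kept : Side → Mono ((m ℕ.+ m) ℕ.+ n) → Bool
  kept t e = isZero (get (opp t) (take (m ℕ.+ m) e))

  -- g ↦ g(y , z) or g(y' , z); and the substitution setting the other copy to 0.
  E : Side → Poly (m ℕ.+ n) → Poly ((m ℕ.+ m) ℕ.+ n)
  E t = reindex (λ _ → true) (embedM t)

  R : Side → Poly ((m ℕ.+ m) ℕ.+ n) → Poly (m ℕ.+ n)
  R t = reindex (kept t) (restrictM t)

  embed-admissible : ∀ t → Admissible m n (m ℕ.+ m) n (λ _ → true) (embedM t)
  embed-admissible t = record
    { test-⊕ = λ _ _ → refl
    ; map-⊕ = λ e f → trans (cong₂ _++_ (trans (cong (put t) (VecP.take-zipWith ℕ._+_ e f)) (put-⊕ t (take m e) (take m f)))
                                          (VecP.drop-zipWith ℕ._+_ e f))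
                             (sym (⊕-++ (put t (take m e)) _ (drop m e) _))
    ; map-deg = λ e _ → trans (degM-++ (put t (take m e)) (drop m e))
                              (trans (cong (ℕ._+ degM (drop m e)) (degM-put t (take m e))) (degM-take-drop m e))
    ; map-z = λ e _ z → trans (take-++ (put t (take m e)) (drop m e)) (trans (cong (put t) z) (put-zeros t))
    }

  restrict-admissible : ∀ t → Admissible (m ℕ.+ m) n m n (kept t) (restrictM t)
  restrict-admissible t = record
    { test-⊕ = λ e f → trans (cong isZero (get-⊕-block (opp t) e f)) (isZero-⊕ (get (opp t) (take (m ℕ.+ m) e)) _)
    ; map-⊕ = λ e f → trans (cong₂ _++_ (get-⊕-block t e f) (VecP.drop-zipWith ℕ._+_ e f))
                             (sym (⊕-++ (get t (take (m ℕ.+ m) e)) _ (drop (m ℕ.+ m) e) _))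
    ; map-deg = deg
    ; map-z = λ e _ z → trans (take-++ (get t (take (m ℕ.+ m) e)) _) (trans (cong (get t) z) (get-zeros t))
    }
    where
    get-⊕-block : ∀ t' e f → get t' (take (m ℕ.+ m) (e ⊕ f)) ≡ get t' (take (m ℕ.+ m) e) ⊕ get t' (take (m ℕ.+ m) f)
    get-⊕-block t' e f = trans (cong (get t') (VecP.take-zipWith ℕ._+_ e f)) (get-⊕ t' _ _)
    deg : ∀ e → kept t e ≡ true → degM (restrictM t e) ≡ degM e
    deg e keptE = begin
      degM (get t w ++ drop (m ℕ.+ m) e)            ≡⟨ degM-++ (get t w) _ ⟩
      degM (get t w) ℕ.+ degM (drop (m ℕ.+ m) e)    ≡⟨ cong (ℕ._+ _) (sym (degM-put t (get t w))) ⟩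
      degM (put t (get t w)) ℕ.+ degM (drop (m ℕ.+ m) e)
        ≡⟨ cong (λ v → degM v ℕ.+ _) (put-get t w (isZero-sound _ keptE)) ⟩
      degM w ℕ.+ degM (drop (m ℕ.+ m) e)            ≡⟨ degM-take-drop (m ℕ.+ m) e ⟩
      degM e                                         ∎
      where
      open ≡-Reasoning
      w = take (m ℕ.+ m) e

  block-embedM : ∀ t e → take (m ℕ.+ m) (embedM t e) ≡ put t (take m e)
  block-embedM t e = take-++ (put t (take m e)) (drop m e)

  R-E : ∀ t (p : Poly (m ℕ.+ n)) → R t (E t p) ≈P p
  R-E t = reindex-retract (kept t) (restrictM t) (embedM t) keeps restores
    where
    keeps : ∀ e → kept t (embedM t e) ≡ true
    keeps e = trans (cong (isZero ∘ get (opp t)) (block-embedM t e)) (trans (cong isZero (get-put-opp t (take m e))) (isZero-zeros m))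
    restores : ∀ e → restrictM t (embedM t e) ≡ e
    restores e = trans (cong₂ _++_ (trans (cong (get t) (block-embedM t e)) (get-put t (take m e))) (drop-++ (put t (take m e)) (drop m e)))
                       (VecP.take++drop≡id m e)

  R-E-opp-onlyZ : ∀ t (p : Poly (m ℕ.+ n)) → OnlyZ m n (R t (E (opp t) p))
  R-E-opp-onlyZ t p = reindex-supp (kept t) (restrictM t) (onlyZ? m n) into (E (opp t) p) copy-t-free
    where
    copy-t-free : Supp (λ e → get t (take (m ℕ.+ m) e) ≡ zeros m) (E (opp t) p)
    copy-t-free = reindex-supp (λ _ → true) (embedM (opp t)) (λ e → get t (take (m ℕ.+ m) e) ≟M zeros m)
      (λ e _ _ → trans (cong (get t) (block-embedM (opp t) e)) (get-opp-put t (take m e))) p (λ _ _ → tt)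
    into : ∀ e → kept t e ≡ true → get t (take (m ℕ.+ m) e) ≡ zeros m → take m (restrictM t e) ≡ zeros m
    into e _ z = trans (take-++ (get t (take (m ℕ.+ m) e)) _) z

  R-E-form : ∀ t t' k (p : Poly (m ℕ.+ n)) → IsForm k p → IsForm k (R t (E t' p))
  R-E-form t t' k p fp = reindex-form (restrict-admissible t) k (E t' p) (reindex-form (embed-admissible t') k p fp)

  twoCopies : (Side → Poly (m ℕ.+ n)) → Poly ((m ℕ.+ m) ℕ.+ n)
  twoCopies P = E left (P left) +P E right (P right)

  R-twoCopies : ∀ t P → R t (twoCopies P) ≈P (P t +P R t (E (opp t) (P (opp t))))
  R-twoCopies t P e = begin
    coeff (R t (twoCopies P)) e
      ≡⟨ cong (λ X → coeff X e) (reindex-++ (kept t) (restrictM t) (E left (P left)) _) ⟩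
    coeff (R t (E left (P left)) +P R t (E right (P right))) e
      ≡⟨ coeff-++ (R t (E left (P left))) _ e ⟩
    coeff (R t (E left (P left))) e + coeff (R t (E right (P right))) e
      ≡⟨ by-side t ⟩
    coeff (P t) e + coeff (R t (E (opp t) (P (opp t)))) e
      ≡⟨ sym (coeff-++ (P t) _ e) ⟩
    coeff (P t +P R t (E (opp t) (P (opp t)))) e ∎
    where
    open ≡-Reasoning
    by-side : ∀ t → coeff (R t (E left (P left))) e + coeff (R t (E right (P right))) e
                  ≡ coeff (P t) e + coeff (R t (E (opp t) (P (opp t)))) e
    by-side left = cong (_+ coeff (R left (E right (P right))) e) (R-E left (P left) e)
    by-side right = trans (ℚP.+-comm (coeff (R right (E left (P left))) e) _) (cong (_+ coeff (R right (E left (P left))) e) (R-E right (P right) e))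

sumP-split : ∀ a b (f : Fin (a ℕ.+ b) → Poly N) → sumP (a ℕ.+ b) f ≡ sumP a (f ∘ (_↑ˡ b)) +P sumP b (f ∘ (a ↑ʳ_))
sumP-split ℕ.zero b f = refl
sumP-split (ℕ.suc a) b f = trans (cong (f zero +P_) (sumP-split a b (f ∘ suc)))
  (sym (ListP.++-assoc (f zero) (sumP a (f ∘ suc ∘ (_↑ˡ b))) _))

combo-cong : (t : ℕ) {c c' : Fin t → ℚ} (f : Fin t → Poly N) → (∀ j → c j ≡ c' j) → combo t c f ≡ combo t c' f
combo-cong t f cc' = sumP-cong t (λ j → cong (λ x → scaleP x (f j)) (cc' j))

combo-zero : (t : ℕ) (c : Fin t → ℚ) (f : Fin t → Poly N) → (∀ j → c j ≡ 0ℚ) → combo t c f ≈P 0P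
combo-zero ℕ.zero c f c₀ e = refl
combo-zero (ℕ.suc t) c f c₀ e = begin
  coeff (scaleP (c zero) (f zero) +P combo t (c ∘ suc) (f ∘ suc)) e
    ≡⟨ coeff-++ (scaleP (c zero) (f zero)) _ e ⟩
  coeff (scaleP (c zero) (f zero)) e + coeff (combo t (c ∘ suc) (f ∘ suc)) e
    ≡⟨ cong₂ _+_ (trans (coeff-scale (c zero) (f zero) e) (cong (_* _) (c₀ zero))) (combo-zero t (c ∘ suc) (f ∘ suc) (c₀ ∘ suc) e) ⟩
  0ℚ * coeff (f zero) e + 0ℚ
    ≡⟨ trans (ℚP.+-identityʳ _) (ℚP.*-zeroˡ (coeff (f zero) e)) ⟩
  0ℚ ∎
  where open ≡-Reasoning

slot : ∀ s → Side → Fin s → Fin (s ℕ.+ s)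
slot s left j = j ↑ˡ s
slot s right j = s ↑ʳ j

nonzero-side : ∀ s (c : Fin (s ℕ.+ s) → ℚ) → ¬ (∀ i → c i ≡ 0ℚ) → Σ Side (λ t → ¬ (∀ j → c (slot s t j) ≡ 0ℚ))
nonzero-side s c c≢0 with FinP.all? (λ j → c (j ↑ˡ s) ℚP.≟ 0ℚ)
... | no left≢0 = left , left≢0
... | yes left₀ = right , λ right₀ → c≢0 (all-zero left₀ right₀)
  where
  all-zero : (∀ j → c (j ↑ˡ s) ≡ 0ℚ) → (∀ j → c (s ↑ʳ j) ≡ 0ℚ) → ∀ i → c i ≡ 0ℚ
  all-zero left₀ right₀ i with splitAt s i in split
  ... | inj₁ j = trans (cong c (sym (FinP.splitAt⁻¹-↑ˡ split))) (left₀ j)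
  ... | inj₂ j = trans (cong c (sym (FinP.splitAt⁻¹-↑ʳ split))) (right₀ j)

least-⇔ : {P Q : ℕ → Set} → (∀ l → P l → Q l) → (∀ l → Q l → P l) →
  ∀ r → (P r × (∀ l → P l → r ≤ l)) ⇔ (Q r × (∀ l → Q l → r ≤ l))
least-⇔ P⇒Q Q⇒P r = mk⇔
  (λ (Pr , least) → P⇒Q r Pr , λ l Ql → least l (Q⇒P l Ql))
  (λ (Qr , least) → Q⇒P r Qr , λ l Pl → least l (P⇒Q l Pl))

module DoubledSystem (m n s : ℕ) (g : Fin s → Poly (m ℕ.+ n)) where
  open Doubling m n

  D : Fin (s ℕ.+ s) → Poly ((m ℕ.+ m) ℕ.+ n)
  D = doubled m n s g

  doubled-slot : ∀ t j → D (slot s t j) ≡ E t (g j)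
  doubled-slot left j rewrite FinP.splitAt-↑ˡ s j s = refl
  doubled-slot right j rewrite FinP.splitAt-↑ʳ s s j = refl

  combo-doubled : ∀ c → combo (s ℕ.+ s) c D ≡ twoCopies (λ t → combo s (c ∘ slot s t) g)
  combo-doubled c = trans (sumP-split s s _) (cong₂ _+P_ (copy left) (copy right))
    where
    copy : ∀ t → sumP s (λ j → scaleP (c (slot s t j)) (D (slot s t j))) ≡ E t (combo s (c ∘ slot s t) g)
    copy t = trans (sumP-cong s (λ j → cong (scaleP (c (slot s t j))) (doubled-slot t j)))
                   (sym (reindex-combo (λ _ → true) (embedM t) s (c ∘ slot s t) g))

  -- h(doubled) ≤ h(g): extend λ by zeros on the copy y'; the combination becomes (λ·g)(y , z),
  -- the image of λ·g under the renaming y ↦ y.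
  extend : ∀ l → SysDecomp m n s g l → SysDecomp (m ℕ.+ m) n (s ℕ.+ s) D l
  extend l (c , c≢0 , dec) =
    c' , (λ c'₀ → c≢0 (λ j → trans (sym (c'-left j)) (c'₀ (j ↑ˡ s)))) ,
    Decomp-resp (m ℕ.+ m) n (combo (s ℕ.+ s) c' D) (E left (combo s c g)) l combo≈ (reindex-Decomp (embed-admissible left) (combo s c g) l dec)
    where
    c' : Fin (s ℕ.+ s) → ℚ
    c' i = [ c , (λ _ → 0ℚ) ]′ (splitAt s i)
    c'-left : ∀ j → c' (j ↑ˡ s) ≡ c j
    c'-left j rewrite FinP.splitAt-↑ˡ s j s = refl
    c'-right : ∀ j → c' (s ↑ʳ j) ≡ 0ℚ
    c'-right j rewrite FinP.splitAt-↑ʳ s s j = refl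
    combo≈ : combo (s ℕ.+ s) c' D ≈P E left (combo s c g)
    combo≈ e = begin
      coeff (combo (s ℕ.+ s) c' D) e
        ≡⟨ cong (λ X → coeff X e) (combo-doubled c') ⟩
      coeff (E left (combo s (c' ∘ slot s left) g) +P E right (combo s (c' ∘ slot s right) g)) e
        ≡⟨ coeff-++ (E left (combo s (c' ∘ slot s left) g)) _ e ⟩
      coeff (E left (combo s (c' ∘ slot s left) g)) e + coeff (E right (combo s (c' ∘ slot s right) g)) e
        ≡⟨ cong₂ _+_ (cong (λ X → coeff (E left X) e) (combo-cong s g c'-left))
                     (reindex-≈ (λ _ → true) (embedM right) (combo s (c' ∘ slot s right) g) 0P (combo-zero s _ g c'-right) e) ⟩
      coeff (E left (combo s c g)) e + 0ℚ
        ≡⟨ ℚP.+-identityʳ _ ⟩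
      coeff (E left (combo s c g)) e ∎
      where open ≡-Reasoning

  -- h(g) ≤ h(doubled): pick a copy t on which the coefficients c are nonzero and set the other
  -- copy to 0.  The combination c·D becomes (λ·g)(y , z), with λ the restriction of c to copy
  -- t, plus a form of degree k in z only, which is absorbed into the z-part.
  restrict : ∀ k → (∀ j → IsForm k (g j)) → ∀ l → SysDecomp (m ℕ.+ m) n (s ℕ.+ s) D l → SysDecomp m n s g l
  restrict k forms l (c , c≢0 , dec) with nonzero-side s c c≢0
  ... | t , λ≢0 = c ∘ slot s t , λ≢0 ,
    absorb m n k l (P t) Q (formP t) (R-E-form t (opp t) k (P (opp t)) (formP (opp t))) (R-E-opp-onlyZ t (P (opp t))) decomp
    where
    P : Side → Poly (m ℕ.+ n)
    P t' = combo s (c ∘ slot s t') g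
    Q : Poly (m ℕ.+ n)
    Q = R t (E (opp t) (P (opp t)))
    formP : ∀ t' → IsForm k (P t')
    formP t' = supp-combo (deg? k) s (c ∘ slot s t') g forms
    decomp : Decomp m n (P t +P Q) l
    decomp = Decomp-resp m n (P t +P Q) (R t (twoCopies P)) l (λ e → sym (R-twoCopies t P e))
      (subst (λ X → Decomp m n (R t X) l) (combo-doubled c) (reindex-Decomp (restrict-admissible t) (combo (s ℕ.+ s) c D) l dec))

lemma2 : (m n s k : ℕ) → 2 ≤ k → (g : Fin s → Poly (m ℕ.+ n)) → (∀ j → IsForm k (g j)) →
    ∀ r → IsSysSchmidtRankZ (m ℕ.+ m) n (s ℕ.+ s) (doubled m n s g) r ⇔ IsSysSchmidtRankZ m n s g r
lemma2 m n s k _ g forms = least-⇔ (restrict k forms) extend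
  where open DoubledSystem m n s g
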